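{- The semigroup $S_\infty$ (under matrix multiplication) has no identity element.
   Context: For integers $d\in\mathbb{Z}$ and $k,m\in\mathbb{N}$ with $1-\min(0,d)\le k\le m$, let $\langle d,k,m\rangle$ denote the infinite matrix $(x_{ij})_{i,j\in\mathbb{N}}$ with $x_{ij}=1$ if $k\le i\le m$ and $j-i=d$, and $x_{ij}=0$ otherwise. Let $\mathbf{0}$ be the infinite zero matrix and $S_\infty=\{\mathbf{0}\}\cup\{\langle d,k,m\rangle: d\in\mathbb{Z},\ k,m\in\mathbb{N},\ 1-\min(0,d)\le k\le m\}$, which is a semigroup under matrix multiplication. -}

module Defs where

open import Data.Nat as ℕ using (ℕ; zero; suc; _≤?_; _<_)
import Data.Nat.Properties as ℕP
open import Data.Integer as ℤ using (ℤ; +_; ∣_∣; _⊓_)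
import Data.Integer.Properties as ℤP
open import Data.Bool using (Bool; true; false; if_then_else_; _∧_)
open import Relation.Nullary using (¬_)
open import Relation.Nullary.Decidable using (⌊_⌋; yes; no)
open import Relation.Binary.PropositionalEquality
open import Data.Empty using (⊥-elim)

-- Infinite matrices with natural-number entries, indexed by ℕ × ℕ.
-- (The paper indexes by positive integers; row/column 0 is always zero
--  for every element of S∞.)
Mat : Set
Mat = ℕ → ℕ → ℕ

record RFMat : Set where
  field
    entry  : Mat
    bound  : ℕ → ℕ
    finite : ∀ i l → bound i < l → entry i l ≡ 0
open RFMat public

sumTo : ℕ → (ℕ → ℕ) → ℕ
sumTo zero    f = f 0
sumTo (suc n) f = sumTo n f ℕ.+ f (suc n)

-- Matrix product (A B)_{ij} = Σ_l A_{il} B_{lj}; since A is row-finite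
-- the infinite sum is the finite sum over l ≤ bound A i.
_·_ : RFMat → RFMat → Mat
(A · B) i j = sumTo (bound A i) (λ l → entry A i l ℕ.* entry B l j)

data S∞ : Set where
  𝟎   : S∞
  ⟨_,_,_⟩[_,_] : (d : ℤ) (k m : ℕ) → (+ 1) ℤ.- ((+ 0) ⊓ d) ℤ.≤ + k → k ℕ.≤ m → S∞

genEntry : ℤ → ℕ → ℕ → Mat
genEntry d k m i j =
  if ⌊ k ≤? i ⌋ ∧ ⌊ i ≤? m ⌋ ∧ ⌊ (+ j) ℤ.- (+ i) ℤ.≟ d ⌋ then 1 else 0

private
  col-bound : ∀ d i l → (+ l) ℤ.- (+ i) ≡ d → l ℕ.≤ i ℕ.+ ∣ d ∣
  col-bound d i l eq = begin
      ∣ + l ∣                   ≡⟨ cong ∣_∣ lem ⟩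
      ∣ (+ i) ℤ.+ d ∣            ≤⟨ ℤP.∣i+j∣≤∣i∣+∣j∣ (+ i) d ⟩
      i ℕ.+ ∣ d ∣               ∎
    where
      open ℕP.≤-Reasoning
      lem : + l ≡ (+ i) ℤ.+ d
      cancel : ((+ l) ℤ.- (+ i)) ℤ.+ (+ i) ≡ + l
      cancel = trans (ℤP.+-assoc (+ l) (ℤ.- (+ i)) (+ i))
                     (trans (cong (λ x → (+ l) ℤ.+ x) (ℤP.+-inverseˡ (+ i))) (ℤP.+-identityʳ (+ l)))
      lem = trans (sym cancel)
                  (trans (cong (λ x → x ℤ.+ (+ i)) eq) (ℤP.+-comm d (+ i)))

  genFinite : ∀ d k m i l → i ℕ.+ ∣ d ∣ < l → genEntry d k m i l ≡ 0
  genFinite d k m i l lt with k ≤? i | i ≤? m | (+ l) ℤ.- (+ i) ℤ.≟ d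
  ... | yes _ | yes _ | yes eq = ⊥-elim (ℕP.<⇒≱ lt (col-bound d i l eq))
  ... | yes _ | yes _ | no _  = refl
  ... | yes _ | no _  | _     = refl
  ... | no _  | _     | _     = refl

toMat : S∞ → RFMat
toMat 𝟎 = record { entry = λ _ _ → 0 ; bound = λ _ → 0 ; finite = λ _ _ _ → refl }
toMat (⟨ d , k , m ⟩[ _ , _ ]) = record
  { entry  = genEntry d k m
  ; bound  = λ i → i ℕ.+ ∣ d ∣
  ; finite = genFinite d k m }

IsIdentity : S∞ → Set
IsIdentity e = ∀ s → (∀ i j → (toMat e · toMat s) i j ≡ entry (toMat s) i j)
                   × (∀ i j → (toMat s · toMat e) i j ≡ entry (toMat s) i j)
  where open import Data.Product using (_×_)

-- Every element of S∞ has a zero row below its support (any row of 𝟎, row m+1 of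
-- ⟨d,k,m⟩), so left multiplication by it annihilates that row; but the matrix unit
-- ⟨0,r,r⟩ on that row r has a 1 there, so no element is a left identity.
module Submission where

open import Defs
open import Data.Product using (Σ; _,_; proj₁)
open import Relation.Nullary using (¬_)
open import Data.Nat as ℕ using (ℕ; zero; suc; _≤?_; s≤s; z≤n)
import Data.Nat.Properties as ℕP
open import Data.Integer as ℤ using (+_)
import Data.Integer.Properties as ℤP
open import Relation.Nullary.Decidable using (yes; no)
open import Relation.Binary.PropositionalEquality
open import Data.Empty using (⊥-elim)

ZeroRow : Mat → ℕ → Set
ZeroRow A i = ∀ l → A i l ≡ 0

sumTo-zero : ∀ n f → (∀ l → f l ≡ 0) → sumTo n f ≡ 0
sumTo-zero zero    f f≡0 = f≡0 0
sumTo-zero (suc n) f f≡0 = cong₂ ℕ._+_ (sumTo-zero n f f≡0) (f≡0 (suc n))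

·-zeroRow : ∀ A B i → ZeroRow (entry A) i → ZeroRow (A · B) i
·-zeroRow A B i rowA≡0 j =
  sumTo-zero (bound A i) _ (λ l → cong (ℕ._* entry B l j) (rowA≡0 l))

genEntry-zeroRow : ∀ d k m → ZeroRow (genEntry d k m) (suc m)
genEntry-zeroRow d k m l with k ≤? suc m | suc m ≤? m
... | yes _ | yes m+1≤m = ⊥-elim (ℕP.1+n≰n m+1≤m)
... | yes _ | no _      = refl
... | no _  | _         = refl

hasZeroRow : (s : S∞) → Σ ℕ λ r → ZeroRow (entry (toMat s)) (suc r)
hasZeroRow 𝟎                     = 0 , λ _ → refl
hasZeroRow ⟨ d , k , m ⟩[ _ , _ ] = m , genEntry-zeroRow d k m

matrixUnit : ℕ → S∞
matrixUnit r = ⟨ + 0 , suc r , suc r ⟩[ ℤ.+≤+ (s≤s z≤n) , ℕP.≤-refl ]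

matrixUnit-diagonal : ∀ r → entry (toMat (matrixUnit r)) (suc r) (suc r) ≡ 1
matrixUnit-diagonal r with suc r ≤? suc r | (+ suc r) ℤ.- (+ suc r) ℤ.≟ + 0
... | yes _  | yes _    = refl
... | no r≰r | _        = ⊥-elim (r≰r ℕP.≤-refl)
... | yes _  | no r-r≢0 = ⊥-elim (r-r≢0 (ℤP.+-inverseʳ (+ suc r)))

proposition2 : ¬ Σ S∞ IsIdentity
proposition2 (e , e-isIdentity) with hasZeroRow e
... | r , rowE≡0 = 0≢1 (begin
    0                                   ≡⟨ sym (·-zeroRow (toMat e) (toMat u) (suc r) rowE≡0 (suc r)) ⟩
    (toMat e · toMat u) (suc r) (suc r) ≡⟨ proj₁ (e-isIdentity u) (suc r) (suc r) ⟩
    entry (toMat u) (suc r) (suc r)     ≡⟨ matrixUnit-diagonal r ⟩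
    1                                   ∎)
  where
  open ≡-Reasoning
  u : S∞
  u = matrixUnit r
  0≢1 : ¬ (0 ≡ 1)
  0≢1 ()
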